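{- For all integers $d>0$ and $r\ge 0$, $f(D(Z(d,r)))=\mathrm{Inv}(w^{(d,r)})$.
   Context: Root system of type $B_n$: $e_1,\dots,e_n$ is the standard basis of $\mathbb{R}^n$, and we set $e_{ -k}=-e_k$ for $k>0$ and $e_0=0$. $\Phi(B_n)=\{\pm e_j\pm e_i:1\le i<j\le n\}\cup\{\pm e_i\}$, positive roots $\Phi^+(B_n)=\{e_j\pm e_i:1\le i<j\le n\}\cup\{e_i:1\le i\le n\}$, $\Phi^-=-\Phi^+$. The Weyl group $W(B_n)$ is the group of signed permutations $w$ of $\{\pm1,\dots,\pm n\}$ with $w(-i)=-w(i)$, written in one-line notation $w(1)w(2)\cdots w(n)$ (with $\bar k=-k$); it acts on $\mathbb{R}^n$ by $w(e_i)=e_{w(i)}$. The inversion set is $\mathrm{Inv}(w)=\Phi^+\cap w\Phi^-$. Shifted diagram of a strict partition $\lambda=(\lambda_1>\cdots>\lambda_d>0)$: $D(\lambda)=\{(i,j-d+i-1):1\le i\le d,1\le j\le\lambda_i\}$ (row $i$ occupies columns $i-d,\dots,\lambda_i-d+i-1$). The trapezoid $Z(d,r)$ is the strict partition $(r+2d-1,r+2d-3,\dots,r+3,r+1)$ with $d$ parts; row $i$ of $D(Z(d,r))$ occupies columns $i-d,\dots,r+d-i$. The labeling $f:D(Z(d,r))\to\Phi^+(B_{d+r})$ is $f(i,j)=e_{d+1-i}-e_j$ if $j\le0$; $f(i,j)=e_{d+1-i}+e_{j+d}$ if $0<j\le r$; $f(i,j)=e_{d+1-i}-e_{j-r}$ if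 $j>r$. The signed permutation $w^{(d,r)}\in W(B_{d+r})$ is given by $w^{(d,r)}(i)=d+i$ for $1\le i\le r$ and $w^{(d,r)}(i)=-(i-r)$ for $r<i\le d+r$. -}

module Defs where

open import Data.Nat as ℕ using (ℕ; zero; suc)
open import Data.Integer as ℤ using (ℤ; +_; -[1+_]; _≤ᵇ_)
open import Data.Bool using (Bool; true; false; if_then_else_)
open import Data.Fin using (Fin; toℕ)
open import Data.List using (List; []; _∷_; length; lookup)
open import Data.Vec as Vec using (Vec; tabulate; replicate; zipWith)
open import Data.Product using (Σ; _×_; _,_; ∃)
open import Data.Sum using (_⊎_)
open import Relation.Binary.PropositionalEquality using (_≡_)

-- Vectors of ℝⁿ with integer coordinates; coordinate k (1-based) is index k-1.
Vect : ℕ → Set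
Vect n = Vec ℤ n

_+v_ : ∀ {n} → Vect n → Vect n → Vect n
_+v_ = zipWith ℤ._+_

-v_ : ∀ {n} → Vect n → Vect n
-v_ = Vec.map (λ x → ℤ.- x)

_-v_ : ∀ {n} → Vect n → Vect n → Vect n
u -v v = u +v (-v v)

0v : ∀ {n} → Vect n
0v = replicate _ (+ 0)

basis : (n k : ℕ) → Vect n
basis n k = tabulate (λ j → if toℕ j ℕ.≡ᵇ k then + 1 else + 0)

e : (n : ℕ) → ℤ → Vect n
e n (+ zero)   = 0v
e n (+ suc k)  = basis n k
e n -[1+ k ]   = -v (basis n k)

PosRoot : (n : ℕ) → Vect n → Set
PosRoot n α =
  (Σ ℕ λ i → Σ ℕ λ j → 1 ℕ.≤ i × i ℕ.< j × j ℕ.≤ n ×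
     (α ≡ e n (+ j) -v e n (+ i) ⊎ α ≡ e n (+ j) +v e n (+ i)))
  ⊎ (Σ ℕ λ i → 1 ℕ.≤ i × i ℕ.≤ n × α ≡ e n (+ i))

NegRoot : (n : ℕ) → Vect n → Set
NegRoot n β = Σ (Vect n) λ γ → PosRoot n γ × β ≡ -v γ

-- a signed permutation in one-line notation: position i (1-based, index i-1) ↦ w(i) ∈ ℤ
SignedMap : ℕ → Set
SignedMap n = Fin n → ℤ

-- linear action: w(e_i) = e_{w(i)}
act : ∀ {n} → SignedMap n → Vect n → Vect n
act {n} w v = Vec.foldr (λ _ → Vect n) _+v_ 0v
  (tabulate λ i → Vec.map (Vec.lookup v i ℤ.*_) (e n (w i)))

Inv : ∀ {n} → SignedMap n → Vect n → Set
Inv {n} w α = PosRoot n α × Σ (Vect n) λ β → NegRoot n β × α ≡ act w β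

-- cells (row, column)
Cell : Set
Cell = ℕ × ℤ

-- shifted diagram of a strict partition λ = (λ₁ > … > λ_d), given as a list:
-- D(λ) = {(i, j-d+i-1) : 1 ≤ i ≤ d, 1 ≤ j ≤ λ_i}
InD : List ℕ → Cell → Set
InD λs (i , c) = Σ (Fin (length λs)) λ k → i ≡ suc (toℕ k) ×
  Σ ℕ λ j → 1 ℕ.≤ j × j ℕ.≤ lookup λs k ×
    c ≡ ((+ j ℤ.- + length λs) ℤ.+ + i) ℤ.- + 1

Z : ℕ → ℕ → List ℕ
Z zero    r = []
Z (suc d) r = (r ℕ.+ 2 ℕ.* d ℕ.+ 1) ∷ Z d r

f : (d r : ℕ) → Cell → Vect (d ℕ.+ r)
f d r (i , j) =
  if j ≤ᵇ + 0 then row -v e n j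
  else if j ≤ᵇ + r then row +v e n (j ℤ.+ + d)
  else row -v e n (j ℤ.- + r)
  where
  n = d ℕ.+ r
  row = e n (+ (suc d) ℤ.- + i)

w : (d r : ℕ) → SignedMap (d ℕ.+ r)
w d r k = if i ℕ.≤ᵇ r then + (d ℕ.+ i) else ℤ.- (+ i ℤ.- + r)
  where i = suc (toℕ k)

InImage : (d r : ℕ) → Vect (d ℕ.+ r) → Set
InImage d r α = Σ Cell λ c → InD (Z d r) c × f d r c ≡ α

-- Both sets are identified with one explicit family of positive roots (indices from 0):
-- e_a + e_m (m < a < d), e_a (a < d), e_{d+s} + e_a (s < r, a < d) and e_a - e_t (t < a < d).
-- In D(Z(d,r)) the box in column c of the row with coordinate a gets the first, second, third or fourth
-- kind according as c < 0, c = 0, 0 < c ≤ r or r < c. On the Weyl side, w^{(d,r)} sends e_k to e_{d+k}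
-- for k < r and e_{r+a} to -e_a, so w(-γ) is computed for every positive γ by cutting its two indices
-- at r. Each resulting root is either one of the labels, or has leading (highest nonzero) coordinate -1,
-- whereas every positive root has leading coordinate +1.

module Submission where

open import Defs
open import Data.Nat using (ℕ; _<_)
open import Function.Bundles using (_⇔_; mk⇔)
open import Data.Nat as ℕ using (zero; suc; _+_; _*_; _∸_; _≤_; _≡ᵇ_; _≤ᵇ_; z≤n; s≤s)
import Data.Nat.Tactic.RingSolver as ℕ-Solver
open import Data.List as List using (length)
import Data.Nat.Properties as ℕ
open import Data.Integer as ℤ using (ℤ; +_; -[1+_])
import Data.Integer.Properties as ℤ
open import Data.Integer.Tactic.RingSolver using (solve-∀)
open import Data.Fin as F using (Fin; toℕ; fromℕ<)
import Data.Fin.Properties as F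
open import Data.Vec using (lookup; tabulate; foldr; map)
import Data.Vec.Properties as Vec
open import Algebra.Properties.CommutativeMonoid.Sum ℤ.+-0-commutativeMonoid
  using (sum-syntax; ∑-distrib-+; sum-cong-≗; sum-replicate-zero)
open import Data.Bool using (true; false; if_then_else_)
open import Data.Product using (∃₂; ∃-syntax; _×_; _,_)
open import Data.Sum using (_⊎_; inj₁; inj₂)
open import Data.Empty using (⊥-elim)
open import Function using (_∘_; case_of_)
import Function.Properties.Equivalence as ⇔
open import Relation.Binary.PropositionalEquality
open import Relation.Nullary using (¬_; yes; no)
open import Relation.Nullary.Reflects using (ofʸ; ofⁿ)

δ : ℕ → ℕ → ℤ
δ i j = if i ≡ᵇ j then + 1 else + 0

δ-diag : ∀ i → δ i i ≡ + 1
δ-diag zero    = refl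
δ-diag (suc i) = δ-diag i

δ-≢ : ∀ {i j} → i ≢ j → δ i j ≡ + 0
δ-≢ {zero}  {zero}  i≢j = ⊥-elim (i≢j refl)
δ-≢ {zero}  {suc j} _   = refl
δ-≢ {suc i} {zero}  _   = refl
δ-≢ {suc i} {suc j} i≢j = δ-≢ (i≢j ∘ cong suc)

-δ≤0 : ∀ i j → ℤ.- δ i j ℤ.≤ + 0
-δ≤0 i j with i ≡ᵇ j
... | false = ℤ.+≤+ z≤n
... | true  = ℤ.-≤+

-- Coordinates of e_z, numbered from 0: coordinate p of e_{k+1} is δ p k.
unit : ℤ → ℕ → ℤ
unit (+ zero)  _ = + 0
unit (+ suc k) p = δ p k
unit -[1+ k ]  p = ℤ.- δ p k

infix 4 _≐_

record _≐_ {n} (v : Vect n) (g : ℕ → ℤ) : Set where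
  constructor coordinates
  field at : ∀ p → lookup v p ≡ g (toℕ p)

open _≐_

≐⇒≡ : ∀ {n} {u v : Vect n} {g} → u ≐ g → v ≐ g → u ≡ v
≐⇒≡ {u = u} {v} u≐g v≐g = begin
  u                   ≡⟨ Vec.tabulate∘lookup u ⟨
  tabulate (lookup u) ≡⟨ Vec.tabulate-cong (λ p → trans (at u≐g p) (sym (at v≐g p))) ⟩
  tabulate (lookup v) ≡⟨ Vec.tabulate∘lookup v ⟩
  v                   ∎
  where open ≡-Reasoning

≐-respʳ : ∀ {n} {v : Vect n} {g h} → g ≗ h → v ≐ g → v ≐ h
≐-respʳ g≗h v≐g = coordinates λ p → trans (at v≐g p) (g≗h (toℕ p))

tabulate-≐ : ∀ {n} (g : ℕ → ℤ) → tabulate {n = n} (g ∘ toℕ) ≐ g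
tabulate-≐ g = coordinates (Vec.lookup∘tabulate (g ∘ toℕ))

e-≐ : ∀ {n} z → e n z ≐ unit z
e-≐ (+ zero)     = coordinates λ p → Vec.lookup-replicate p (+ 0)
e-≐ (+ suc k)    = coordinates (Vec.lookup∘tabulate _)
e-≐ {n} -[1+ k ] = coordinates λ p →
  trans (Vec.lookup-map p ℤ.-_ (basis n k)) (cong ℤ.-_ (Vec.lookup∘tabulate _ p))

+v-≐ : ∀ {n} {u v : Vect n} {g h} → u ≐ g → v ≐ h → u +v v ≐ λ p → g p ℤ.+ h p
+v-≐ {u = u} {v} u≐g v≐h = coordinates λ p →
  trans (Vec.lookup-zipWith ℤ._+_ p u v) (cong₂ ℤ._+_ (at u≐g p) (at v≐h p))

e-≐-index : ∀ {n z z′} → z ≡ z′ → e n z ≐ unit z′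
e-≐-index {z = z} refl = e-≐ z

-v-≐ : ∀ {n} {v : Vect n} {g} → v ≐ g → -v v ≐ λ p → ℤ.- g p
-v-≐ {v = v} v≐g = coordinates λ p → trans (Vec.lookup-map p ℤ.-_ v) (cong ℤ.-_ (at v≐g p))

-v≐ : ∀ {n} {u v : Vect n} {g h} → u ≐ g → v ≐ h → u -v v ≐ λ p → g p ℤ.- h p
-v≐ u≐g v≐h = +v-≐ u≐g (-v-≐ v≐h)

∑-δ : ∀ {n} a (X : ℕ → ℤ) → a < n → ∑[ i < n ] (δ (toℕ i) a ℤ.* X (toℕ i)) ≡ X a
∑-δ {suc n} zero X _ = begin
  + 1 ℤ.* X 0 ℤ.+ ∑[ i < n ] (+ 0) ≡⟨ cong₂ ℤ._+_ (ℤ.*-identityˡ (X 0)) (sum-replicate-zero n) ⟩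
  X 0 ℤ.+ + 0                       ≡⟨ ℤ.+-identityʳ (X 0) ⟩
  X 0                               ∎
  where open ≡-Reasoning
∑-δ {suc n} (suc a) X (s≤s a<n) = trans (ℤ.+-identityˡ _) (∑-δ a (X ∘ suc) a<n)

lookup-foldr-+v : ∀ {n m} (g : Fin m → Vect n) p →
  lookup (foldr (λ _ → Vect n) _+v_ 0v (tabulate g)) p ≡ ∑[ i < m ] lookup (g i) p
lookup-foldr-+v {m = zero}  g p = Vec.lookup-replicate p (+ 0)
lookup-foldr-+v {n} {suc m} g p =
  trans (Vec.lookup-zipWith ℤ._+_ p (g F.zero) (foldr (λ _ → Vect n) _+v_ 0v (tabulate (g ∘ F.suc))))
        (cong (λ s → lookup (g F.zero) p ℤ.+ s) (lookup-foldr-+v (g ∘ F.suc) p))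

lookup-act : ∀ {n} (w : SignedMap n) v p →
  lookup (act w v) p ≡ ∑[ i < n ] (lookup v i ℤ.* unit (w i) (toℕ p))
lookup-act {n} w v p =
  trans (lookup-foldr-+v (λ i → map (lookup v i ℤ.*_) (e n (w i))) p)
        (sum-cong-≗ λ i → trans (Vec.lookup-map p (lookup v i ℤ.*_) (e n (w i)))
                                (cong (lookup v i ℤ.*_) (at (e-≐ (w i)) p)))

infix 8 e[_] e[_]+e[_] e[_]-e[_]

-- Indices are numbered from 0: e[ a ] stands for e_{a+1}.
data Root : Set where
  e[_]                : ℕ → Root
  e[_]+e[_] e[_]-e[_] : ℕ → ℕ → Root

⟦_⟧ : Root → ℕ → ℤ
⟦ e[ a ]        ⟧ p = δ p a
⟦ e[ a ]+e[ b ] ⟧ p = δ p a ℤ.+ δ p b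
⟦ e[ a ]-e[ b ] ⟧ p = δ p a ℤ.- δ p b

IsPositive : ℕ → Root → Set
IsPositive n e[ a ]        = a < n
IsPositive n e[ a ]+e[ b ] = b < a × a < n
IsPositive n e[ a ]-e[ b ] = b < a × a < n

posRoot⇒root : ∀ {n} {α : Vect n} → PosRoot n α → ∃[ φ ] IsPositive n φ × α ≐ ⟦ φ ⟧
posRoot⇒root (inj₁ (suc b , suc a , _ , s≤s b<a , a<n , inj₁ refl)) =
  e[ a ]-e[ b ] , (b<a , a<n) , -v≐ (e-≐ (+ suc a)) (e-≐ (+ suc b))
posRoot⇒root (inj₁ (suc b , suc a , _ , s≤s b<a , a<n , inj₂ refl)) =
  e[ a ]+e[ b ] , (b<a , a<n) , +v-≐ (e-≐ (+ suc a)) (e-≐ (+ suc b))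
posRoot⇒root (inj₂ (suc a , _ , a<n , refl)) = e[ a ] , a<n , e-≐ (+ suc a)

root⇒posRoot : ∀ {n} {α : Vect n} φ → IsPositive n φ → α ≐ ⟦ φ ⟧ → PosRoot n α
root⇒posRoot e[ a ]        a<n         α≐φ = inj₂ (suc a , s≤s z≤n , a<n , ≐⇒≡ α≐φ (e-≐ (+ suc a)))
root⇒posRoot e[ a ]+e[ b ] (b<a , a<n) α≐φ =
  inj₁ (suc b , suc a , s≤s z≤n , s≤s b<a , a<n , inj₂ (≐⇒≡ α≐φ (+v-≐ (e-≐ (+ suc a)) (e-≐ (+ suc b)))))
root⇒posRoot e[ a ]-e[ b ] (b<a , a<n) α≐φ =
  inj₁ (suc b , suc a , s≤s z≤n , s≤s b<a , a<n , inj₁ (≐⇒≡ α≐φ (-v≐ (e-≐ (+ suc a)) (e-≐ (+ suc b)))))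

leading : Root → ℕ
leading e[ a ]        = a
leading e[ a ]+e[ _ ] = a
leading e[ a ]-e[ _ ] = a

leading<n : ∀ {n} φ → IsPositive n φ → leading φ < n
leading<n e[ _ ]        a<n       = a<n
leading<n e[ _ ]+e[ _ ] (_ , a<n) = a<n
leading<n e[ _ ]-e[ _ ] (_ , a<n) = a<n

⟦⟧-leading : ∀ {n} φ → IsPositive n φ → ⟦ φ ⟧ (leading φ) ≡ + 1
⟦⟧-leading e[ a ]        _         = δ-diag a
⟦⟧-leading e[ a ]+e[ b ] (b<a , _) rewrite δ-diag a | δ-≢ (ℕ.>⇒≢ b<a) = refl
⟦⟧-leading e[ a ]-e[ b ] (b<a , _) rewrite δ-diag a | δ-≢ (ℕ.>⇒≢ b<a) = refl

⟦⟧-above-leading : ∀ {n} φ → IsPositive n φ → ∀ {q} → leading φ < q → ⟦ φ ⟧ q ≡ + 0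
⟦⟧-above-leading e[ a ] _ a<q = δ-≢ (ℕ.>⇒≢ a<q)
⟦⟧-above-leading e[ a ]+e[ b ] (b<a , _) a<q
  rewrite δ-≢ (ℕ.>⇒≢ a<q) | δ-≢ (ℕ.>⇒≢ (ℕ.<-trans b<a a<q)) = refl
⟦⟧-above-leading e[ a ]-e[ b ] (b<a , _) a<q
  rewrite δ-≢ (ℕ.>⇒≢ a<q) | δ-≢ (ℕ.>⇒≢ (ℕ.<-trans b<a a<q)) = refl

posRoot-leading : ∀ {n} {α : Vect n} → PosRoot n α →
  ∃[ p ] lookup α p ≡ + 1 × (∀ q → toℕ p < toℕ q → lookup α q ≡ + 0)
posRoot-leading Pα with posRoot⇒root Pα
... | φ , φ+ , α≐φ = p , αp≡1 , above
  where
  p = fromℕ< (leading<n φ φ+)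
  toℕ-p : toℕ p ≡ leading φ
  toℕ-p = F.toℕ-fromℕ< (leading<n φ φ+)
  αp≡1 = trans (at α≐φ p) (trans (cong ⟦ φ ⟧ toℕ-p) (⟦⟧-leading φ φ+))
  above = λ q p<q → trans (at α≐φ q) (⟦⟧-above-leading φ φ+ (subst (_< toℕ q) toℕ-p p<q))

+1≰0 : ¬ (+ 1 ℤ.≤ + 0)
+1≰0 (ℤ.+≤+ ())

¬posRoot-nonpositive : ∀ {n} {α : Vect n} {g} → α ≐ g → (∀ p → g p ℤ.≤ + 0) → ¬ PosRoot n α
¬posRoot-nonpositive α≐g g≤0 Pα with posRoot-leading Pα
... | p , αp≡1 , _ = +1≰0 (subst (ℤ._≤ + 0) (trans (sym (at α≐g p)) αp≡1) (g≤0 (toℕ p)))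

¬posRoot-e-e : ∀ {n x y} {α : Vect n} → x < y → y < n → α ≐ (λ p → δ p x ℤ.- δ p y) → ¬ PosRoot n α
¬posRoot-e-e {x = x} {y} {α} x<y y<n α≐ Pα with posRoot-leading Pα
... | p , αp≡1 , above with toℕ p ℕ.≟ x
...   | no p≢x = +1≰0 (subst (ℤ._≤ + 0) (trans (sym αp≡-δ) αp≡1) (-δ≤0 (toℕ p) y))
  where
  αp≡-δ : lookup α p ≡ ℤ.- δ (toℕ p) y
  αp≡-δ = trans (at α≐ p) (trans (cong (ℤ._- δ (toℕ p) y) (δ-≢ p≢x)) (ℤ.+-identityˡ _))
...   | yes refl = case -1≡0 of λ ()
  where
  q = fromℕ< y<n
  -1≡0 : -[1+ 0 ] ≡ + 0
  -1≡0 = begin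
    -[1+ 0 ]                              ≡⟨ cong₂ ℤ._-_ (δ-≢ (ℕ.>⇒≢ x<y)) (δ-diag y) ⟨
    δ y (toℕ p) ℤ.- δ y y                 ≡⟨ cong (λ k → δ k (toℕ p) ℤ.- δ k y) (F.toℕ-fromℕ< y<n) ⟨
    δ (toℕ q) (toℕ p) ℤ.- δ (toℕ q) y     ≡⟨ at α≐ q ⟨
    lookup α q                            ≡⟨ above q (subst (toℕ p <_) (sym (F.toℕ-fromℕ< y<n)) x<y) ⟩
    + 0                                   ∎
    where open ≡-Reasoning

⟪_⟫ : Root → (ℕ → ℤ) → ℤ
⟪ e[ a ]        ⟫ Y = Y a
⟪ e[ a ]+e[ b ] ⟫ Y = Y a ℤ.+ Y b
⟪ e[ a ]-e[ b ] ⟫ Y = Y a ℤ.- Y b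

∑-δ+δ : ∀ {n a b} → a < n → b < n → (X Y : ℕ → ℤ) →
  ∑[ i < n ] (δ (toℕ i) a ℤ.* X (toℕ i) ℤ.+ δ (toℕ i) b ℤ.* Y (toℕ i)) ≡ X a ℤ.+ Y b
∑-δ+δ {n} {a} {b} a<n b<n X Y =
  trans (∑-distrib-+ {n} (λ i → δ (toℕ i) a ℤ.* X (toℕ i)) (λ i → δ (toℕ i) b ℤ.* Y (toℕ i)))
        (cong₂ ℤ._+_ (∑-δ a X a<n) (∑-δ b Y b<n))

∑-⟦⟧ : ∀ {n} φ → IsPositive n φ → (Y : ℕ → ℤ) →
  ∑[ i < n ] (⟦ φ ⟧ (toℕ i) ℤ.* Y (toℕ i)) ≡ ⟪ φ ⟫ Y
∑-⟦⟧ e[ a ] a<n Y = ∑-δ a Y a<n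
∑-⟦⟧ {n} e[ a ]+e[ b ] (b<a , a<n) Y =
  trans (sum-cong-≗ {n} λ i → ℤ.*-distribʳ-+ (Y (toℕ i)) (δ (toℕ i) a) (δ (toℕ i) b))
        (∑-δ+δ a<n (ℕ.<-trans b<a a<n) Y Y)
∑-⟦⟧ {n} e[ a ]-e[ b ] (b<a , a<n) Y =
  trans (sum-cong-≗ {n} λ i → distrib (δ (toℕ i) a) (δ (toℕ i) b) (Y (toℕ i)))
        (∑-δ+δ a<n (ℕ.<-trans b<a a<n) Y (ℤ.-_ ∘ Y))
  where
  distrib : ∀ x y z → (x ℤ.- y) ℤ.* z ≡ x ℤ.* z ℤ.+ y ℤ.* ℤ.- z
  distrib = solve-∀

act-negRoot : ∀ {n} (w : SignedMap n) {W : ℕ → ℤ} → (∀ i → w i ≡ W (toℕ i)) →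
  ∀ {γ : Vect n} ψ → IsPositive n ψ → γ ≐ ⟦ ψ ⟧ →
  act w (-v γ) ≐ λ p → ⟪ ψ ⟫ (λ k → ℤ.- unit (W k) p)
act-negRoot {n} w {W} w≡W {γ} ψ ψ+ γ≐ψ = coordinates λ p → begin
  lookup (act w (-v γ)) p
    ≡⟨ lookup-act w (-v γ) p ⟩
  ∑[ i < n ] (lookup (-v γ) i ℤ.* unit (w i) (toℕ p))
    ≡⟨ sum-cong-≗ {n} (λ i → cong₂ ℤ._*_ (at (-v-≐ γ≐ψ) i) (cong (λ z → unit z (toℕ p)) (w≡W i))) ⟩
  ∑[ i < n ] (ℤ.- ⟦ ψ ⟧ (toℕ i) ℤ.* unit (W (toℕ i)) (toℕ p))
    ≡⟨ sum-cong-≗ {n} (λ i → let x = ⟦ ψ ⟧ (toℕ i); y = unit (W (toℕ i)) (toℕ p) in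
                           trans (sym (ℤ.neg-distribˡ-* x y)) (ℤ.neg-distribʳ-* x y)) ⟩
  ∑[ i < n ] (⟦ ψ ⟧ (toℕ i) ℤ.* ℤ.- unit (W (toℕ i)) (toℕ p))
    ≡⟨ ∑-⟦⟧ ψ ψ+ (λ k → ℤ.- unit (W k) (toℕ p)) ⟩
  ⟪ ψ ⟫ (λ k → ℤ.- unit (W k) (toℕ p))
    ∎
  where open ≡-Reasoning

data Cut (r : ℕ) : ℕ → Set where
  below : ∀ {k} → k < r → Cut r k
  above : ∀ a → Cut r (r + a)

cut : ∀ r k → Cut r k
cut r k with k ℕ.<? r
... | yes k<r = below k<r
... | no k≮r with ℕ.m≤n⇒∃[o]m+o≡n (ℕ.≮⇒≥ k≮r)
...   | a , refl = above a

if-≤ᵇ : ∀ {A : Set} m n {x y : A} → m ≤ n → (if m ≤ᵇ n then x else y) ≡ x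
if-≤ᵇ m n m≤n with m ≤ᵇ n | ℕ.≤ᵇ-reflects-≤ m n
... | true  | _       = refl
... | false | ofⁿ m≰n = ⊥-elim (m≰n m≤n)

if-≰ᵇ : ∀ {A : Set} m n {x y : A} → n < m → (if m ≤ᵇ n then x else y) ≡ y
if-≰ᵇ m n n<m with m ≤ᵇ n | ℕ.≤ᵇ-reflects-≤ m n
... | true  | ofʸ m≤n = ⊥-elim (ℕ.<⇒≱ n<m m≤n)
... | false | _       = refl

+[m+n]-m : ∀ m n → + (m + n) ℤ.- + m ≡ + n
+[m+n]-m m n = trans (cong (ℤ._- + m) (ℤ.pos-+ m n)) (cancel (+ m) (+ n))
  where
  cancel : ∀ x y → (x ℤ.+ y) ℤ.- x ≡ y
  cancel = solve-∀

+[1+m+n]-m : ∀ m n → + suc (m + n) ℤ.- + m ≡ + suc n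
+[1+m+n]-m m n = trans (cong (λ k → + k ℤ.- + m) (sym (ℕ.+-suc m n))) (+[m+n]-m m (suc n))

length-Z : ∀ d r → length (Z d r) ≡ d
length-Z zero    r = refl
length-Z (suc d) r = cong suc (length-Z d r)

lookup-Z : ∀ d r (k : Fin (length (Z d r))) → List.lookup (Z d r) k ≡ r + 2 * (d ∸ suc (toℕ k)) + 1
lookup-Z (suc d) r F.zero    = refl
lookup-Z (suc d) r (F.suc k) = lookup-Z d r k

row-length : ∀ r a → r + 2 * a + 1 ≡ suc (a + r + a)
row-length = ℕ-Solver.solve-∀

column-offset : ∀ {i a d} → i + a ≡ d → ∀ j → ((+ suc j ℤ.- + d) ℤ.+ + i) ℤ.- + 1 ≡ + j ℤ.- + a
column-offset {i} {a} refl j =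
  trans (cong (λ z → ((+ suc j ℤ.- z) ℤ.+ + i) ℤ.- + 1) (ℤ.pos-+ i a)) (shift (+ j) (+ i) (+ a))
  where
  shift : ∀ J I A → ((+ 1 ℤ.+ J ℤ.- (I ℤ.+ A)) ℤ.+ I) ℤ.- + 1 ≡ J ℤ.- A
  shift = solve-∀

left-column : ∀ j m → -[1+ m ] ≡ + j ℤ.- + (suc j + m)
left-column j m = sym (trans (cong (λ z → + j ℤ.- z) (ℤ.pos-+ (suc j) m)) (shift (+ j) (+ m)))
  where
  shift : ∀ J M → J ℤ.- ((+ 1 ℤ.+ J) ℤ.+ M) ≡ ℤ.- (+ 1 ℤ.+ M)
  shift = solve-∀

right-position : ∀ a r t → a + suc (r + t) ≡ a + r + suc t
right-position a r t = trans (cong (λ x → a + x) (sym (ℕ.+-suc r t))) (sym (ℕ.+-assoc a r (suc t)))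

module _ (d r : ℕ) where

  -- The labels f(i, j), sorted by the four column ranges j < 0, j = 0, 0 < j ≤ r and r < j.
  data Label : Root → Set where
    left     : ∀ {a m} → m < a → a < d → Label e[ a ]+e[ m ]
    diagonal : ∀ {a}   → a < d → Label e[ a ]
    middle   : ∀ {a s} → s < r → a < d → Label e[ d + s ]+e[ a ]
    right    : ∀ {a t} → t < a → a < d → Label e[ a ]-e[ t ]

  Labelled : Vect (d + r) → Set
  Labelled α = ∃[ φ ] Label φ × α ≐ ⟦ φ ⟧

  <d⇒<n : ∀ {a} → a < d → a < d + r
  <d⇒<n a<d = ℕ.<-≤-trans a<d (ℕ.m≤m+n d r)

  <d⇒r+<n : ∀ {a} → a < d → r + a < d + r
  <d⇒r+<n {a} a<d = subst (r + a <_) (ℕ.+-comm r d) (ℕ.+-monoʳ-< r a<d)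

  r+<n⇒<d : ∀ {a} → r + a < d + r → a < d
  r+<n⇒<d {a} r+a<n = ℕ.+-cancelˡ-< r a d (subst (r + a <_) (ℕ.+-comm d r) r+a<n)

  <r⇒d+<n : ∀ {s} → s < r → d + s < d + r
  <r⇒d+<n = ℕ.+-monoʳ-< d

  -- w d r i reduces to wℕ (toℕ i)
  wℕ : ℕ → ℤ
  wℕ k = if suc k ≤ᵇ r then + (d + suc k) else ℤ.- (+ suc k ℤ.- + r)

  -- coordinate p of w(-e_{k+1})
  wNeg : ℕ → ℕ → ℤ
  wNeg p k = ℤ.- unit (wℕ k) p

  wNeg-below : ∀ {s} p → s < r → wNeg p s ≡ ℤ.- δ p (d + s)
  wNeg-below {s} p s<r = begin
    ℤ.- unit (wℕ s) p              ≡⟨ cong (λ z → ℤ.- unit z p) (if-≤ᵇ (suc s) r s<r) ⟩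
    ℤ.- unit (+ (d + suc s)) p     ≡⟨ cong (λ k → ℤ.- unit (+ k) p) (ℕ.+-suc d s) ⟩
    ℤ.- δ p (d + s)                ∎
    where open ≡-Reasoning

  wNeg-above : ∀ a p → wNeg p (r + a) ≡ δ p a
  wNeg-above a p = begin
    ℤ.- unit (wℕ (r + a)) p
      ≡⟨ cong (λ z → ℤ.- unit z p) (if-≰ᵇ (suc (r + a)) r (s≤s (ℕ.m≤m+n r a))) ⟩
    ℤ.- unit (ℤ.- (+ suc (r + a) ℤ.- + r)) p
      ≡⟨ cong (λ z → ℤ.- unit (ℤ.- z) p) (+[1+m+n]-m r a) ⟩
    ℤ.- ℤ.- δ p a
      ≡⟨ ℤ.neg-involutive (δ p a) ⟩
    δ p a
      ∎
    where open ≡-Reasoning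

  label-positive : ∀ {φ} → Label φ → IsPositive (d + r) φ
  label-positive (left m<a a<d)    = m<a , <d⇒<n a<d
  label-positive (diagonal a<d)    = <d⇒<n a<d
  label-positive (middle s<r a<d)  = ℕ.<-≤-trans a<d (ℕ.m≤m+n d _) , <r⇒d+<n s<r
  label-positive (right t<a a<d)   = t<a , <d⇒<n a<d

  preimage : ∀ {φ} → Label φ → Root
  preimage (left {a} {m} _ _)   = e[ r + a ]+e[ r + m ]
  preimage (diagonal {a} _)     = e[ r + a ]
  preimage (middle {a} {s} _ _) = e[ r + a ]-e[ s ]
  preimage (right {a} {t} _ _)  = e[ r + a ]-e[ r + t ]

  preimage-positive : ∀ {φ} (ℓ : Label φ) → IsPositive (d + r) (preimage ℓ)
  preimage-positive (left m<a a<d)   = ℕ.+-monoʳ-< r m<a , <d⇒r+<n a<d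
  preimage-positive (diagonal a<d)   = <d⇒r+<n a<d
  preimage-positive (middle s<r a<d) = ℕ.<-≤-trans s<r (ℕ.m≤m+n r _) , <d⇒r+<n a<d
  preimage-positive (right t<a a<d)  = ℕ.+-monoʳ-< r t<a , <d⇒r+<n a<d

  preimage-sent : ∀ {φ} (ℓ : Label φ) p → ⟪ preimage ℓ ⟫ (wNeg p) ≡ ⟦ φ ⟧ p
  preimage-sent (left {a} {m} _ _)    p = cong₂ ℤ._+_ (wNeg-above a p) (wNeg-above m p)
  preimage-sent (diagonal {a} _)      p = wNeg-above a p
  preimage-sent (middle {a} {s} s<r _) p =
    trans (cong₂ ℤ._-_ (wNeg-above a p) (wNeg-below p s<r)) (swap (δ p a) (δ p (d + s)))
    where
    swap : ∀ x y → x ℤ.- ℤ.- y ≡ y ℤ.+ x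
    swap = solve-∀
  preimage-sent (right {a} {t} _ _)   p = cong₂ ℤ._-_ (wNeg-above a p) (wNeg-above t p)

  preimage-or-¬posRoot : ∀ ψ → IsPositive (d + r) ψ →
    (∃₂ λ φ (ℓ : Label φ) → ψ ≡ preimage ℓ) ⊎
    (∀ {α} → α ≐ (λ p → ⟪ ψ ⟫ (wNeg p)) → ¬ PosRoot (d + r) α)
  preimage-or-¬posRoot e[ q ] q<n with cut r q
  ... | below q<r = inj₂ λ α≐ → ¬posRoot-nonpositive α≐ λ p →
          subst (ℤ._≤ + 0) (sym (wNeg-below p q<r)) (-δ≤0 p (d + q))
  ... | above a = inj₁ (_ , diagonal (r+<n⇒<d q<n) , refl)
  preimage-or-¬posRoot e[ q ]+e[ p ] (p<q , q<n) with cut r q | cut r p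
  ... | below q<r | _ = inj₂ λ α≐ → ¬posRoot-nonpositive α≐ λ x →
          subst (ℤ._≤ + 0) (sym (cong₂ ℤ._+_ (wNeg-below x q<r) (wNeg-below x (ℕ.<-trans p<q q<r))))
                (ℤ.+-mono-≤ (-δ≤0 x (d + q)) (-δ≤0 x (d + p)))
  ... | above a | below p<r = inj₂ λ α≐ →
          ¬posRoot-e-e (ℕ.<-≤-trans (r+<n⇒<d q<n) (ℕ.m≤m+n d p)) (<r⇒d+<n p<r)
            (≐-respʳ (λ x → cong₂ ℤ._+_ (wNeg-above a x) (wNeg-below x p<r)) α≐)
  ... | above a | above t = inj₁ (_ , left (ℕ.+-cancelˡ-< r t a p<q) (r+<n⇒<d q<n) , refl)
  preimage-or-¬posRoot e[ q ]-e[ p ] (p<q , q<n) with cut r q | cut r p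
  ... | below q<r | _ = inj₂ λ α≐ →
          ¬posRoot-e-e (ℕ.+-monoʳ-< d p<q) (<r⇒d+<n q<r)
            (≐-respʳ (λ x → trans (cong₂ ℤ._-_ (wNeg-below x q<r) (wNeg-below x (ℕ.<-trans p<q q<r)))
                                  (swap (δ x (d + q)) (δ x (d + p)))) α≐)
    where
    swap : ∀ x y → ℤ.- x ℤ.- ℤ.- y ≡ y ℤ.- x
    swap = solve-∀
  ... | above a | below p<r = inj₁ (_ , middle p<r (r+<n⇒<d q<n) , refl)
  ... | above a | above t   = inj₁ (_ , right (ℕ.+-cancelˡ-< r t a p<q) (r+<n⇒<d q<n) , refl)

  inversion⇔labelled : ∀ {α} → Inv (w d r) α ⇔ Labelled α
  inversion⇔labelled = mk⇔ inversion⇒labelled labelled⇒inversion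
    where
    act-w : ∀ {γ} ψ → IsPositive (d + r) ψ → γ ≐ ⟦ ψ ⟧ → act (w d r) (-v γ) ≐ λ p → ⟪ ψ ⟫ (wNeg p)
    act-w = act-negRoot (w d r) {wℕ} (λ _ → refl)

    inversion⇒labelled : ∀ {α} → Inv (w d r) α → Labelled α
    inversion⇒labelled (Pα , _ , (γ , Pγ , refl) , refl) with posRoot⇒root Pγ
    ... | ψ , ψ+ , γ≐ψ with preimage-or-¬posRoot ψ ψ+
    ...   | inj₁ (φ , ℓ , refl) = φ , ℓ , ≐-respʳ (preimage-sent ℓ) (act-w ψ ψ+ γ≐ψ)
    ...   | inj₂ ¬posRoot      = ⊥-elim (¬posRoot (act-w ψ ψ+ γ≐ψ) Pα)

    labelled⇒inversion : ∀ {α} → Labelled α → Inv (w d r) α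
    labelled⇒inversion (φ , ℓ , α≐φ) =
      root⇒posRoot φ (label-positive ℓ) α≐φ , -v γ , (γ , root⇒posRoot ψ ψ+ γ≐ψ , refl) ,
      ≐⇒≡ α≐φ (≐-respʳ (preimage-sent ℓ) (act-w ψ ψ+ γ≐ψ))
      where
      ψ = preimage ℓ
      ψ+ = preimage-positive ℓ
      γ = tabulate (⟦ ψ ⟧ ∘ toℕ)
      γ≐ψ = tabulate-≐ ⟦ ψ ⟧

  row : ∀ {φ} → Label φ → ℕ
  row (left {a} _ _)     = a
  row (diagonal {a} _)   = a
  row (middle {a} _ _)   = a
  row (right {a} _ _)    = a

  row<d : ∀ {φ} (ℓ : Label φ) → row ℓ < d
  row<d (left _ a<d)     = a<d
  row<d (diagonal a<d)   = a<d
  row<d (middle _ a<d)   = a<d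
  row<d (right _ a<d)    = a<d

  column : ∀ {φ} → Label φ → ℤ
  column (left {m = m} _ _)   = -[1+ m ]
  column (diagonal _)         = + 0
  column (middle {s = s} _ _) = + suc s
  column (right {t = t} _ _)  = + suc (r + t)

  cell : ∀ {φ} → Label φ → Cell
  cell ℓ = d ∸ row ℓ , column ℓ

  -- Row a of the labelling (coordinate e_{a+1} first) is row i = d - a of D(Z(d,r)); its j-th box
  -- (counting from 0) lies in column j - a.
  InTrapezoid : Cell → Set
  InTrapezoid (i , c) = ∃[ a ] a < d × i ≡ d ∸ a × ∃[ j ] j ≤ a + r + a × c ≡ + j ℤ.- + a

  InD⇒InTrapezoid : ∀ {x} → InD (Z d r) x → InTrapezoid x
  InD⇒InTrapezoid (k , refl , suc j , s≤s z≤n , j<λ , refl) =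
    a , a<d , sym (ℕ.m∸[m∸n]≡n k<d) , j , j≤ , column≡
    where
    k<d : toℕ k < d
    k<d = subst (toℕ k <_) (length-Z d r) (F.toℕ<n k)
    a = d ∸ suc (toℕ k)
    a<d : a < d
    a<d = ℕ.∸-monoʳ-< (s≤s z≤n) k<d
    j≤ : j ≤ a + r + a
    j≤ = ℕ.≤-pred (subst (suc j ≤_) (trans (lookup-Z d r k) (row-length r a)) j<λ)
    column≡ : ((+ suc j ℤ.- + length (Z d r)) ℤ.+ + suc (toℕ k)) ℤ.- + 1 ≡ + j ℤ.- + a
    column≡ = trans (cong (λ L → ((+ suc j ℤ.- + L) ℤ.+ + suc (toℕ k)) ℤ.- + 1) (length-Z d r))
                    (column-offset (ℕ.m+[n∸m]≡n k<d) j)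

  InTrapezoid⇒InD : ∀ {x} → InTrapezoid x → InD (Z d r) x
  InTrapezoid⇒InD (a , a<d , refl , j , j≤ , refl) = k , i≡ , suc j , s≤s z≤n , j<λ , column≡
    where
    k : Fin (length (Z d r))
    k = fromℕ< (subst (d ∸ suc a <_) (sym (length-Z d r)) (ℕ.∸-monoʳ-< (s≤s z≤n) a<d))
    toℕ-k : toℕ k ≡ d ∸ suc a
    toℕ-k = F.toℕ-fromℕ< _
    i≡ : d ∸ a ≡ suc (toℕ k)
    i≡ = trans (ℕ.+-∸-assoc 1 a<d) (cong suc (sym toℕ-k))
    a≡ : d ∸ suc (toℕ k) ≡ a
    a≡ = trans (cong (d ∸_) (sym i≡)) (ℕ.m∸[m∸n]≡n (ℕ.<⇒≤ a<d))
    j<λ : suc j ≤ List.lookup (Z d r) k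
    j<λ = subst (suc j ≤_) (sym (trans (lookup-Z d r k) (trans (cong (λ b → r + 2 * b + 1) a≡) (row-length r a))))
                (s≤s j≤)
    column≡ : + j ℤ.- + a ≡ ((+ suc j ℤ.- + length (Z d r)) ℤ.+ + (d ∸ a)) ℤ.- + 1
    column≡ = sym (trans (cong (λ L → ((+ suc j ℤ.- + L) ℤ.+ + (d ∸ a)) ℤ.- + 1) (length-Z d r))
                         (column-offset (ℕ.m∸n+n≡m (ℕ.<⇒≤ a<d)) j))

  column-label : ∀ {a j} → a < d → j ≤ a + r + a →
    ∃₂ λ φ (ℓ : Label φ) → row ℓ ≡ a × column ℓ ≡ + j ℤ.- + a
  column-label {a} {j} a<d j≤ with cut a j
  ... | below j<a with ℕ.m≤n⇒∃[o]m+o≡n j<a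
  ...   | m , refl = _ , left (ℕ.m<n+m m (s≤s z≤n)) a<d , refl , left-column j m
  column-label {a} a<d j≤ | above zero    = _ , diagonal a<d , refl , sym (+[m+n]-m a 0)
  column-label {a} a<d j≤ | above (suc s) with cut r s
  ... | below s<r = _ , middle s<r a<d , refl , sym (+[m+n]-m a (suc s))
  ... | above t   = _ , right t<a a<d , refl , sym (+[m+n]-m a (suc (r + t)))
    where
    t<a : t < a
    t<a = ℕ.+-cancelˡ-≤ (a + r) (suc t) a (subst (_≤ a + r + a) (right-position a r t) j≤)

  cell-InTrapezoid : ∀ {φ} (ℓ : Label φ) → InTrapezoid (cell ℓ)
  cell-InTrapezoid ℓ = row ℓ , row<d ℓ , refl , position ℓ
    where
    position : ∀ {φ} (ℓ : Label φ) → ∃[ j ] j ≤ row ℓ + r + row ℓ × column ℓ ≡ + j ℤ.- + row ℓ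
    position (left {a} {m} m<a _) = a ∸ suc m ,
      ℕ.≤-trans (ℕ.m∸n≤m a (suc m)) (ℕ.≤-trans (ℕ.m≤m+n a r) (ℕ.m≤m+n (a + r) a)) ,
      trans (left-column (a ∸ suc m) m) (cong (λ b → + (a ∸ suc m) ℤ.- + b) eq)
      where
      eq : suc (a ∸ suc m) + m ≡ a
      eq = trans (sym (ℕ.+-suc (a ∸ suc m) m)) (ℕ.m∸n+n≡m m<a)
    position (diagonal {a} _)     = a , ℕ.≤-trans (ℕ.m≤m+n a r) (ℕ.m≤m+n (a + r) a) , sym (ℤ.+-inverseʳ (+ a))
    position (middle {a} {s} s<r _) = a + suc s ,
      ℕ.≤-trans (ℕ.+-monoʳ-≤ a s<r) (ℕ.m≤m+n (a + r) a) , sym (+[m+n]-m a (suc s))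
    position (right {a} {t} t<a _)  = a + suc (r + t) ,
      subst (_≤ a + r + a) (sym (right-position a r t)) (ℕ.+-monoʳ-≤ (a + r) t<a) ,
      sym (+[m+n]-m a (suc (r + t)))

  InTrapezoid⇒cell : ∀ {x} → InTrapezoid x → ∃₂ λ φ (ℓ : Label φ) → x ≡ cell ℓ
  InTrapezoid⇒cell (a , a<d , refl , j , j≤ , refl) with column-label a<d j≤
  ... | φ , ℓ , row≡ , column≡ = φ , ℓ , cong₂ _,_ (cong (d ∸_) (sym row≡)) (sym column≡)

  row-index : ∀ {a} → a < d → + suc d ℤ.- + (d ∸ a) ≡ + suc a
  row-index {a} a<d = trans (cong (λ k → + k ℤ.- + (d ∸ a)) suc-d) (+[m+n]-m (d ∸ a) (suc a))
    where
    suc-d : suc d ≡ d ∸ a + suc a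
    suc-d = sym (trans (ℕ.+-suc (d ∸ a) a) (cong suc (ℕ.m∸n+n≡m (ℕ.<⇒≤ a<d))))

  row-≐ : ∀ {a} → a < d → e (d + r) (+ suc d ℤ.- + (d ∸ a)) ≐ λ p → δ p a
  row-≐ a<d = e-≐-index (row-index a<d)

  f-cell : ∀ {φ} (ℓ : Label φ) → f d r (cell ℓ) ≐ ⟦ φ ⟧
  f-cell (left {a} {m} _ a<d) =
    ≐-respʳ (λ p → cong (λ z → δ p a ℤ.+ z) (ℤ.neg-involutive (δ p m))) (-v≐ (row-≐ a<d) (e-≐ -[1+ m ]))
  f-cell (diagonal {a} a<d) =
    ≐-respʳ (λ p → ℤ.+-identityʳ (δ p a)) (-v≐ (row-≐ a<d) (e-≐ (+ 0)))
  f-cell (middle {a} {s} s<r a<d) =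
    subst (_≐ ⟦ e[ d + s ]+e[ a ] ⟧) (sym (if-≤ᵇ (suc s) r s<r))
      (≐-respʳ (λ p → trans (ℤ.+-comm (δ p a) (δ p (s + d))) (cong (λ k → δ p k ℤ.+ δ p a) (ℕ.+-comm s d)))
               (+v-≐ (row-≐ a<d) (e-≐ (+ suc (s + d)))))
  f-cell (right {a} {t} _ a<d) =
    subst (_≐ ⟦ e[ a ]-e[ t ] ⟧) (sym (if-≰ᵇ (suc (r + t)) r (s≤s (ℕ.m≤m+n r t))))
      (-v≐ (row-≐ a<d) (e-≐-index (+[1+m+n]-m r t)))

  image⇔labelled : ∀ {α} → InImage d r α ⇔ Labelled α
  image⇔labelled = mk⇔ image⇒labelled labelled⇒image
    where
    image⇒labelled : ∀ {α} → InImage d r α → Labelled α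
    image⇒labelled (x , x∈D , refl) with InTrapezoid⇒cell (InD⇒InTrapezoid x∈D)
    ... | φ , ℓ , refl = φ , ℓ , f-cell ℓ

    labelled⇒image : ∀ {α} → Labelled α → InImage d r α
    labelled⇒image (φ , ℓ , α≐φ) = cell ℓ , InTrapezoid⇒InD (cell-InTrapezoid ℓ) , ≐⇒≡ (f-cell ℓ) α≐φ

proposition3p1 : (d r : ℕ) → 0 < d → (α : Vect (d Data.Nat.+ r)) → InImage d r α ⇔ Inv (w d r) α
proposition3p1 d r _ α = ⇔.trans (image⇔labelled d r) (⇔.sym (inversion⇔labelled d r))
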